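{- For $w,v\in\mathfrak{H}^{0}$ we have \begin{align*} \operatorname{ds}(w,v)=-\tau(D(\tau(w),\tau(v))). \end{align*}
   Context: Let $\mathfrak{H}=\mathbb{Q}\langle x,y\rangle$, $\mathfrak{H}^0=\mathbb{Q}+x\mathfrak{H}y$, $z_k=x^{k-1}y$. The stuffle product $\ast$ is given by $z_iw\ast z_jv=z_i(w\ast z_jv)+z_j(z_iw\ast v)+z_{i+j}(w\ast v)$, and the shuffle product $\mathbin{\sqcup\!\sqcup}$ on $\mathfrak{H}$ by $\alpha w\mathbin{\sqcup\!\sqcup}\beta v=\alpha(w\mathbin{\sqcup\!\sqcup}\beta v)+\beta(\alpha w\mathbin{\sqcup\!\sqcup}v)$ for $\alpha,\beta\in\{x,y\}$, both with ${\bf 1}$ as unit. $\operatorname{ds}(w,v)=w\mathbin{\sqcup\!\sqcup}v-w\ast v$. $\tau$ is the anti-automorphism of $\mathfrak{H}$ exchanging $x$ and $y$. Let $\diamond_{Sh}$ be given by $x\diamond_{Sh}y=y\diamond_{Sh}x=-xy$, $y\diamond_{Sh}y=-yy$, $x\diamond_{Sh}x=xy$, and $\mathbin{\sqcup\!\sqcup}_{Sh}$ by $\alpha w\mathbin{\sqcup\!\sqcup}_{Sh}\beta v=\alpha(w\mathbin{\sqcup\!\sqcup}_{Sh}\beta v)+\beta(\alpha w\mathbin{\sqcup\!\sqcup}_{Sh}v)+(\alpha\diamond_{Sh}\beta)(w\mathbin{\sqcup\!\sqcup}_{Sh}v)$. $D(\alpha w,\beta v)$ denotes the collection of all terms of $\alpha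 w\mathbin{\sqcup\!\sqcup}_{Sh}\beta v$ coming from the $\diamond_{Sh}$ part, i.e. $\alpha w\mathbin{\sqcup\!\sqcup}_{Sh}\beta v=\alpha w\mathbin{\sqcup\!\sqcup}\beta v+D(\alpha w,\beta v)$. -}

module Defs where

open import Data.Bool using (Bool; true; false; if_then_else_)
open import Data.Nat using (ℕ; zero; suc) renaming (_+_ to _+ℕ_)
open import Data.List using (List; []; _∷_; _++_; map; concatMap; reverse; foldr)
open import Data.List.Relation.Unary.All using (All)
open import Data.Maybe using (Maybe; just; nothing) renaming (map to mapMaybe)
open import Data.Product using (Σ; _×_; _,_; proj₁; proj₂)
open import Data.Sum using (_⊎_)
open import Data.Rational using (ℚ; 0ℚ; 1ℚ; _+_; _*_; -_)
open import Relation.Binary.PropositionalEquality using (_≡_)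

-- Letters x, y of the alphabet of 𝔥 = ℚ⟨x,y⟩.
data Letter : Set where
  x y : Letter

Word : Set
Word = List Letter

_==L_ : Letter → Letter → Bool
x ==L x = true
y ==L y = true
_ ==L _ = false

_==W_ : Word → Word → Bool
[] ==W [] = true
(a ∷ u) ==W (b ∷ v) = if a ==L b then u ==W v else false
_ ==W _ = false

Poly : Set
Poly = List (ℚ × Word)

coeff : Poly → Word → ℚ
coeff [] u = 0ℚ
coeff ((c , w) ∷ p) u = (if w ==W u then c else 0ℚ) + coeff p u

_≈_ : Poly → Poly → Set
p ≈ q = ∀ u → coeff p u ≡ coeff q u

infix 4 _≈_

wd : Word → Poly
wd u = (1ℚ , u) ∷ []

_⊕_ : Poly → Poly → Poly
p ⊕ q = p ++ q

scale : ℚ → Poly → Poly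
scale c = map (λ t → (c * proj₁ t , proj₂ t))

neg : Poly → Poly
neg = scale (- 1ℚ)

_⊖_ : Poly → Poly → Poly
p ⊖ q = p ⊕ neg q

lmul : Word → Poly → Poly
lmul a = map (λ t → (proj₁ t , a ++ proj₂ t))

bilin : (Word → Word → Poly) → Poly → Poly → Poly
bilin f p q = concatMap (λ s → concatMap (λ t → scale (proj₁ s * proj₁ t) (f (proj₂ s) (proj₂ t))) q) p

-- 𝔥⁰ = ℚ + x𝔥y : words that are empty or of the form x m y.
InH0W : Word → Set
InH0W u = u ≡ [] ⊎ Σ Word (λ m → u ≡ x ∷ (m ++ y ∷ []))

InH0 : Poly → Set
InH0 p = All (λ t → InH0W (proj₂ t)) p

swapL : Letter → Letter
swapL x = y
swapL y = x

τW : Word → Word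
τW u = reverse (map swapL u)

τ : Poly → Poly
τ = map (λ t → (proj₁ t , τW (proj₂ t)))

shW : Word → Word → Poly
shW [] v = wd v
shW (a ∷ w) [] = wd (a ∷ w)
shW (a ∷ w) (b ∷ v) = lmul (a ∷ []) (shW w (b ∷ v)) ⊕ lmul (b ∷ []) (shW (a ∷ w) v)

_⧢_ : Poly → Poly → Poly
_⧢_ = bilin shW

-- stuffle product on index sequences (k₁,…,kᵣ) ↔ z_{k₁}⋯z_{kᵣ}, kᵢ ≥ 1
zW : ℕ → Word
zW zero = y ∷ []         -- only used with k ≥ 1; zW (suc n) = xⁿ y
zW (suc zero) = y ∷ []
zW (suc (suc n)) = x ∷ zW (suc n)

zsW : List ℕ → Word
zsW [] = []
zsW (k ∷ ks) = zW k ++ zsW ks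

stZ : List ℕ → List ℕ → Poly
stZ [] v = wd (zsW v)
stZ (i ∷ w) [] = wd (zsW (i ∷ w))
stZ (i ∷ w) (j ∷ v) =
  lmul (zW i) (stZ w (j ∷ v)) ⊕ (lmul (zW j) (stZ (i ∷ w) v) ⊕ lmul (zW (i +ℕ j)) (stZ w v))

-- parse a word of 𝔥¹ = ℚ + 𝔥y as z_{k₁}⋯z_{kᵣ}; nothing if it does not end in y
parseZ : ℕ → Word → Maybe (List ℕ)
parseZ zero [] = just []
parseZ (suc _) [] = nothing
parseZ n (x ∷ u) = parseZ (suc n) u
parseZ n (y ∷ u) = mapMaybe (suc n ∷_) (parseZ zero u)

-- stuffle on words (junk value 0 outside 𝔥¹; only used on 𝔥⁰)
stW : Word → Word → Poly
stW w v with parseZ zero w | parseZ zero v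
... | just ks | just ls = stZ ks ls
... | _ | _ = []

_✱_ : Poly → Poly → Poly
_✱_ = bilin stW

ds : Poly → Poly → Poly
ds p q = (p ⧢ q) ⊖ (p ✱ q)

⋄Sh : Letter → Letter → Poly
⋄Sh x y = (- 1ℚ , x ∷ y ∷ []) ∷ []
⋄Sh y x = (- 1ℚ , x ∷ y ∷ []) ∷ []
⋄Sh y y = (- 1ℚ , y ∷ y ∷ []) ∷ []
⋄Sh x x = (1ℚ , x ∷ y ∷ []) ∷ []

pmul : Poly → Poly → Poly
pmul = bilin (λ u v → wd (u ++ v))

shShW : Word → Word → Poly
shShW [] v = wd v
shShW (a ∷ w) [] = wd (a ∷ w)
shShW (a ∷ w) (b ∷ v) =
  lmul (a ∷ []) (shShW w (b ∷ v)) ⊕ (lmul (b ∷ []) (shShW (a ∷ w) v) ⊕ pmul (⋄Sh a b) (shShW w v))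

_⧢Sh_ : Poly → Poly → Poly
_⧢Sh_ = bilin shShW

D : Poly → Poly → Poly
D p q = (p ⧢Sh q) ⊖ (p ⧢ q)

-- Both ⧢ and ⧢Sh are quasi-shuffle products on the letters x, y:
--   a w · b v = a (w · b v) + b (a w · v) + (a ⋄ b) (w · v),
-- with a ⋄ b = 0 for ⧢ and a ⋄ b = a ⋄Sh b for ⧢Sh, and such a product is determined by
-- its diamond.  A quasi-shuffle product satisfies the same recursion on last letters, so its
-- conjugate τ(τw · τv) is again a quasi-shuffle product, with diamond τ(τa ⋄ τb).  Hence ⧢ is
-- τ-invariant.  On 𝔥¹, rewriting z_k = x z_{k-1}, the stuffle recursion becomes a letter
-- recursion whose diamond is exactly the τ-conjugate of ⋄Sh, so w ∗ v = τ(τw ⧢Sh τv), and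
--   ds(w,v) = τ(τw ⧢ τv) − τ(τw ⧢Sh τv) = −τ(D(τw,τv)).
-- Elements of 𝔥 are compared through their pairings ⟪ p , g ⟫ = Σ c·g(u) with all test
-- functions g : Word → ℚ, which determine every coefficient.

module Submission where

open import Defs
open import Data.Bool using (true; false; if_then_else_)
open import Data.List using (List; []; _∷_; _++_; [_]; _∷ʳ_; map; reverse; concatMap)
open import Data.List.Properties
  using (++-assoc; ++-identityʳ; map-++; map-∘; map-cong; map-id; reverse-++; reverse-map; reverse-involutive)
open import Data.List.Relation.Unary.All as All using (All; []; _∷_)
open import Data.Maybe using (just; nothing) renaming (map to mapMaybe)
open import Data.Nat using (ℕ; zero; suc) renaming (_+_ to _+ℕ_)
open import Data.Product using (Σ-syntax; _,_; proj₁; proj₂)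
open import Data.Rational using (ℚ; 0ℚ; 1ℚ; _+_; _*_; -_)
open import Data.Rational.Properties
  using (+-identityˡ; +-identityʳ; +-assoc; *-identityˡ; *-identityʳ; *-zeroˡ; *-zeroʳ; *-assoc; *-distribˡ-+)
open import Data.Rational.Solver using (module +-*-Solver)
open import Data.Sum using (inj₁; inj₂)
open import Data.Unit using (tt)
open import Function using (_∘_)
open import Level using (0ℓ)
open import Relation.Binary.PropositionalEquality using (_≡_; refl; sym; trans; cong; cong₂; module ≡-Reasoning)
open import Relation.Unary using (Pred; U)

open +-*-Solver using (solve; _:+_; _:*_; _:=_; con)
open ≡-Reasoning

⟪_,_⟫ : Poly → (Word → ℚ) → ℚ
⟪ [] , g ⟫ = 0ℚ
⟪ (c , u) ∷ p , g ⟫ = c * g u + ⟪ p , g ⟫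

infixr 4 _⊳_
infixl 8 _⊲_

_⊳_ : Word → (Word → ℚ) → Word → ℚ
(u ⊳ g) z = g (u ++ z)

_⊲_ : (Word → ℚ) → Word → Word → ℚ
(g ⊲ u) z = g (z ++ u)

⟪⟫-cong-local : ∀ p {g h : Word → ℚ} → All (λ t → g (proj₂ t) ≡ h (proj₂ t)) p →
  ⟪ p , g ⟫ ≡ ⟪ p , h ⟫
⟪⟫-cong-local [] [] = refl
⟪⟫-cong-local ((c , u) ∷ p) (e ∷ es) = cong₂ (λ a b → c * a + b) e (⟪⟫-cong-local p es)

⟪⟫-cong : ∀ p {g h : Word → ℚ} → (∀ u → g u ≡ h u) → ⟪ p , g ⟫ ≡ ⟪ p , h ⟫
⟪⟫-cong p e = ⟪⟫-cong-local p (All.universal (e ∘ proj₂) p)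

⟪⟫-++ : ∀ p q g → ⟪ p ++ q , g ⟫ ≡ ⟪ p , g ⟫ + ⟪ q , g ⟫
⟪⟫-++ [] q g = sym (+-identityˡ _)
⟪⟫-++ ((c , u) ∷ p) q g = trans (cong (c * g u +_) (⟪⟫-++ p q g)) (sym (+-assoc (c * g u) _ _))

⟪⟫-scale : ∀ c p g → ⟪ scale c p , g ⟫ ≡ c * ⟪ p , g ⟫
⟪⟫-scale c [] g = sym (*-zeroʳ c)
⟪⟫-scale c ((d , u) ∷ p) g =
  trans (cong₂ _+_ (*-assoc c d (g u)) (⟪⟫-scale c p g)) (sym (*-distribˡ-+ c (d * g u) _))

⟪⟫-⊖ : ∀ p q g → ⟪ p ⊖ q , g ⟫ ≡ ⟪ p , g ⟫ + - 1ℚ * ⟪ q , g ⟫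
⟪⟫-⊖ p q g = trans (⟪⟫-++ p (neg q) g) (cong (⟪ p , g ⟫ +_) (⟪⟫-scale (- 1ℚ) q g))

⟪⟫-lmul : ∀ u p g → ⟪ lmul u p , g ⟫ ≡ ⟪ p , u ⊳ g ⟫
⟪⟫-lmul u [] g = refl
⟪⟫-lmul u ((c , w) ∷ p) g = cong (c * g (u ++ w) +_) (⟪⟫-lmul u p g)

⟪⟫-τ : ∀ p g → ⟪ τ p , g ⟫ ≡ ⟪ p , g ∘ τW ⟫
⟪⟫-τ [] g = refl
⟪⟫-τ ((c , u) ∷ p) g = cong (c * g (τW u) +_) (⟪⟫-τ p g)

⟪⟫-wd : ∀ u g → ⟪ wd u , g ⟫ ≡ g u
⟪⟫-wd u g = trans (+-identityʳ _) (*-identityˡ _)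

⟪⟫-concatMap-scale : ∀ (F : Word → Poly) c q g →
  ⟪ concatMap (λ t → scale (c * proj₁ t) (F (proj₂ t))) q , g ⟫ ≡ c * ⟪ q , (λ b → ⟪ F b , g ⟫) ⟫
⟪⟫-concatMap-scale F c [] g = sym (*-zeroʳ c)
⟪⟫-concatMap-scale F c ((d , b) ∷ q) g = begin
  ⟪ scale (c * d) (F b) ++ rest , g ⟫           ≡⟨ ⟪⟫-++ (scale (c * d) (F b)) rest g ⟩
  ⟪ scale (c * d) (F b) , g ⟫ + ⟪ rest , g ⟫    ≡⟨ cong₂ _+_ (⟪⟫-scale (c * d) (F b) g) (⟪⟫-concatMap-scale F c q g) ⟩
  c * d * ⟪ F b , g ⟫ + c * ⟪ q , Fg ⟫          ≡⟨ cong (_+ c * ⟪ q , Fg ⟫) (*-assoc c d _) ⟩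
  c * (d * ⟪ F b , g ⟫) + c * ⟪ q , Fg ⟫        ≡⟨ *-distribˡ-+ c _ _ ⟨
  c * (d * ⟪ F b , g ⟫ + ⟪ q , Fg ⟫)            ∎
  where
  rest : Poly
  rest = concatMap (λ t → scale (c * proj₁ t) (F (proj₂ t))) q
  Fg : Word → ℚ
  Fg b = ⟪ F b , g ⟫

⟪⟫-bilin : ∀ f p q g → ⟪ bilin f p q , g ⟫ ≡ ⟪ p , (λ a → ⟪ q , (λ b → ⟪ f a b , g ⟫) ⟫) ⟫
⟪⟫-bilin f [] q g = refl
⟪⟫-bilin f ((c , a) ∷ p) q g =
  trans (⟪⟫-++ (concatMap (λ t → scale (c * proj₁ t) (f a (proj₂ t))) q) _ g)
        (cong₂ _+_ (⟪⟫-concatMap-scale (f a) c q g) (⟪⟫-bilin f p q g))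

⟪⟫-⊳⊲ : ∀ p u z g → ⟪ p , (u ⊳ g) ⊲ z ⟫ ≡ ⟪ p , u ⊳ g ⊲ z ⟫
⟪⟫-⊳⊲ p u z g = ⟪⟫-cong p (λ w → cong g (sym (++-assoc u w z)))

coeff-⟪⟫ : ∀ p u → coeff p u ≡ ⟪ p , (λ w → if w ==W u then 1ℚ else 0ℚ) ⟫
coeff-⟪⟫ [] u = refl
coeff-⟪⟫ ((c , w) ∷ p) u with w ==W u
... | true  = cong₂ _+_ (sym (*-identityʳ c)) (coeff-⟪⟫ p u)
... | false = cong₂ _+_ (sym (*-zeroʳ c)) (coeff-⟪⟫ p u)

≈-by-⟪⟫ : ∀ {p q} → (∀ g → ⟪ p , g ⟫ ≡ ⟪ q , g ⟫) → p ≈ q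
≈-by-⟪⟫ {p} {q} e u = trans (coeff-⟪⟫ p u) (trans (e _) (sym (coeff-⟪⟫ q u)))

swapL-involutive : ∀ a → swapL (swapL a) ≡ a
swapL-involutive x = refl
swapL-involutive y = refl

τW-++ : ∀ u v → τW (u ++ v) ≡ τW v ++ τW u
τW-++ u v = trans (cong reverse (map-++ swapL u v)) (reverse-++ (map swapL u) (map swapL v))

τW-involutive : ∀ u → τW (τW u) ≡ u
τW-involutive u = begin
  reverse (map swapL (reverse (map swapL u)))   ≡⟨ cong reverse (reverse-map swapL (map swapL u)) ⟩
  reverse (reverse (map swapL (map swapL u)))   ≡⟨ reverse-involutive _ ⟩
  map swapL (map swapL u)                       ≡⟨ map-∘ u ⟨
  map (swapL ∘ swapL) u                         ≡⟨ map-cong swapL-involutive u ⟩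
  map (λ a → a) u                               ≡⟨ map-id u ⟩
  u                                             ∎

τW-∷ : ∀ a u → τW (a ∷ u) ≡ τW u ∷ʳ swapL a
τW-∷ a u = τW-++ [ a ] u

-- The letter diamond a ⋄ b is the monomial c a b · d a b.  The recursion is only required on
-- Dom, because the stuffle product satisfies it on 𝔥¹ only.
HeadRecursion : (Letter → Letter → ℚ) → (Letter → Letter → Word) → (Word → Word → Poly) →
                Letter → Word → Letter → Word → (Word → ℚ) → Set
HeadRecursion c d P a w b v g =
  ⟪ P (a ∷ w) (b ∷ v) , g ⟫ ≡
  ⟪ P w (b ∷ v) , [ a ] ⊳ g ⟫ + (⟪ P (a ∷ w) v , [ b ] ⊳ g ⟫ + c a b * ⟪ P w v , d a b ⊳ g ⟫)

record IsQuasiShuffleOn (Dom : Pred Word 0ℓ) (c : Letter → Letter → ℚ) (d : Letter → Letter → Word)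
                        (P : Word → Word → Poly) : Set where
  field
    []-left  : ∀ v → Dom v → ∀ g → ⟪ P [] v , g ⟫ ≡ g v
    []-right : ∀ w → Dom w → ∀ g → ⟪ P w [] , g ⟫ ≡ g w
    ∷-∷      : ∀ a w b v → Dom (a ∷ w) → Dom (b ∷ v) → ∀ g → HeadRecursion c d P a w b v g

TailClosed : Pred Word 0ℓ → Set
TailClosed Dom = ∀ {a w} → Dom (a ∷ w) → Dom w

recursion-cong : ∀ {a a′ b b′ e e′} k → a ≡ a′ → b ≡ b′ → e ≡ e′ →
  a + (b + k * e) ≡ a′ + (b′ + k * e′)
recursion-cong k p q r = cong₂ _+_ p (cong₂ (λ s t → s + k * t) q r)

quasiShuffle-unique : ∀ {Dom c d P Q} → TailClosed Dom →
  IsQuasiShuffleOn Dom c d P → IsQuasiShuffleOn Dom c d Q →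
  ∀ w v → Dom w → Dom v → ∀ g → ⟪ P w v , g ⟫ ≡ ⟪ Q w v , g ⟫
quasiShuffle-unique tail qsP qsQ [] v _ dv g =
  trans (IsQuasiShuffleOn.[]-left qsP v dv g) (sym (IsQuasiShuffleOn.[]-left qsQ v dv g))
quasiShuffle-unique tail qsP qsQ (a ∷ w) [] dw _ g =
  trans (IsQuasiShuffleOn.[]-right qsP (a ∷ w) dw g) (sym (IsQuasiShuffleOn.[]-right qsQ (a ∷ w) dw g))
quasiShuffle-unique {c = c} tail qsP qsQ (a ∷ w) (b ∷ v) dw dv g =
  trans (IsQuasiShuffleOn.∷-∷ qsP a w b v dw dv g)
    (trans (recursion-cong (c a b) (quasiShuffle-unique tail qsP qsQ w (b ∷ v) (tail dw) dv _)
                                   (quasiShuffle-unique tail qsP qsQ (a ∷ w) v dw (tail dv) _)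
                                   (quasiShuffle-unique tail qsP qsQ w v (tail dw) (tail dv) _))
           (sym (IsQuasiShuffleOn.∷-∷ qsQ a w b v dw dv g)))

module LastLetterRecursion {c d P} (qs : IsQuasiShuffleOn U c d P) where
  open IsQuasiShuffleOn qs

  lastExpansion : Word → Word → Letter → Letter → (Word → ℚ) → ℚ
  lastExpansion w v α β g =
    ⟪ P w (v ∷ʳ β) , g ⊲ [ α ] ⟫ + (⟪ P (w ∷ʳ α) v , g ⊲ [ β ] ⟫ + c α β * ⟪ P w v , g ⊲ d α β ⟫)

  LastRecursion : Word → Word → Letter → Letter → (Word → ℚ) → Set
  LastRecursion w v α β g = ⟪ P (w ∷ʳ α) (v ∷ʳ β) , g ⟫ ≡ lastExpansion w v α β g

  ∷-∷-⊲ : ∀ a w b v z g →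
    ⟪ P (a ∷ w) (b ∷ v) , g ⊲ z ⟫ ≡
    ⟪ P w (b ∷ v) , [ a ] ⊳ g ⊲ z ⟫ + (⟪ P (a ∷ w) v , [ b ] ⊳ g ⊲ z ⟫ + c a b * ⟪ P w v , (d a b ⊳ g) ⊲ z ⟫)
  ∷-∷-⊲ a w b v z g =
    trans (∷-∷ a w b v _ _ (g ⊲ z))
          (cong (λ t → ⟪ P w (b ∷ v) , [ a ] ⊳ g ⊲ z ⟫ + (⟪ P (a ∷ w) v , [ b ] ⊳ g ⊲ z ⟫ + c a b * t))
                (sym (⟪⟫-⊳⊲ (P w v) (d a b) z g)))

  lastRecursion-[]-[] : ∀ α β g → LastRecursion [] [] α β g
  lastRecursion-[]-[] α β g =
    trans lhs (trans (swap (g (α ∷ β ∷ [])) (g (β ∷ α ∷ [])) (c α β) (g (d α β))) (sym rhs))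
    where
    swap : ∀ A B k X → A + (B + k * X) ≡ B + (A + k * X)
    swap = solve 4 (λ A B k X → A :+ (B :+ k :* X) := B :+ (A :+ k :* X)) refl
    lhs : ⟪ P [ α ] [ β ] , g ⟫ ≡ g (α ∷ β ∷ []) + (g (β ∷ α ∷ []) + c α β * g (d α β))
    lhs = trans (∷-∷ α [] β [] _ _ g)
      (recursion-cong (c α β) ([]-left [ β ] _ _) ([]-right [ α ] _ _)
                              (trans ([]-left [] _ _) (cong g (++-identityʳ (d α β)))))
    rhs : lastExpansion [] [] α β g ≡ g (β ∷ α ∷ []) + (g (α ∷ β ∷ []) + c α β * g (d α β))
    rhs = recursion-cong (c α β) ([]-left [ β ] _ _) ([]-right [ α ] _ _) ([]-left [] _ _)

  lastRecursion-[]ˡ : ∀ v α β g → LastRecursion [] v α β g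
  lastRecursion-[]ˡ [] α β g = lastRecursion-[]-[] α β g
  lastRecursion-[]ˡ (b ∷ v) α β g = trans lhs (trans (rearrange A₁ A₂ M X₁ X₂ (c α β) (c α b)) (sym rhs))
    where
    A₁ A₂ M X₁ X₂ : ℚ
    A₁ = g (α ∷ b ∷ v ∷ʳ β)
    A₂ = g (b ∷ v ∷ʳ β ∷ʳ α)
    M  = ⟪ P [ α ] v , [ b ] ⊳ g ⊲ [ β ] ⟫
    X₁ = g (b ∷ v ++ d α β)
    X₂ = g (d α b ++ v ∷ʳ β)
    rearrange : ∀ A₁ A₂ M X₁ X₂ k₁ k₂ →
      A₁ + ((A₂ + (M + k₁ * X₁)) + k₂ * X₂) ≡ A₂ + ((A₁ + (M + k₂ * X₂)) + k₁ * X₁)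
    rearrange = solve 7 (λ A₁ A₂ M X₁ X₂ k₁ k₂ →
      A₁ :+ ((A₂ :+ (M :+ k₁ :* X₁)) :+ k₂ :* X₂) := A₂ :+ ((A₁ :+ (M :+ k₂ :* X₂)) :+ k₁ :* X₁)) refl
    lhs : ⟪ P [ α ] (b ∷ v ∷ʳ β) , g ⟫ ≡ A₁ + ((A₂ + (M + c α β * X₁)) + c α b * X₂)
    lhs = trans (∷-∷ α [] b (v ∷ʳ β) _ _ g)
      (cong₂ _+_ ([]-left (b ∷ v ∷ʳ β) _ _)
        (cong₂ (λ s t → s + c α b * t)
          (trans (lastRecursion-[]ˡ v α β ([ b ] ⊳ g))
                 (recursion-cong (c α β) ([]-left (v ∷ʳ β) _ _) (refl {x = M}) ([]-left v _ ([ b ] ⊳ g ⊲ d α β))))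
          ([]-left (v ∷ʳ β) _ _)))
    rhs : lastExpansion [] (b ∷ v) α β g ≡ A₂ + ((A₁ + (M + c α b * X₂)) + c α β * X₁)
    rhs = cong₂ _+_ ([]-left (b ∷ v ∷ʳ β) _ _)
      (cong₂ (λ s t → s + c α β * t)
        (trans (∷-∷-⊲ α [] b v [ β ] g)
               (recursion-cong (c α b) ([]-left (b ∷ v) _ _) (refl {x = M}) ([]-left v _ ((d α b ⊳ g) ⊲ [ β ]))))
        ([]-left (b ∷ v) _ _))

  lastRecursion-[]ʳ : ∀ w α β g → LastRecursion w [] α β g
  lastRecursion-[]ʳ [] α β g = lastRecursion-[]-[] α β g
  lastRecursion-[]ʳ (a ∷ w) α β g = trans lhs (trans (rearrange M G₁ G₂ X₁ X₂ (c a β) (c α β)) (sym rhs))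
    where
    M G₁ G₂ X₁ X₂ : ℚ
    M  = ⟪ P w [ β ] , [ a ] ⊳ g ⊲ [ α ] ⟫
    G₁ = g (a ∷ w ∷ʳ α ∷ʳ β)
    G₂ = g (β ∷ a ∷ w ∷ʳ α)
    X₁ = g (a ∷ w ++ d α β)
    X₂ = g (d a β ++ w ∷ʳ α)
    rearrange : ∀ M G₁ G₂ X₁ X₂ k₁ k₂ →
      (M + (G₁ + k₂ * X₁)) + (G₂ + k₁ * X₂) ≡ (M + (G₂ + k₁ * X₂)) + (G₁ + k₂ * X₁)
    rearrange = solve 7 (λ M G₁ G₂ X₁ X₂ k₁ k₂ →
      (M :+ (G₁ :+ k₂ :* X₁)) :+ (G₂ :+ k₁ :* X₂) := (M :+ (G₂ :+ k₁ :* X₂)) :+ (G₁ :+ k₂ :* X₁)) refl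
    lhs : ⟪ P (a ∷ w ∷ʳ α) [ β ] , g ⟫ ≡ (M + (G₁ + c α β * X₁)) + (G₂ + c a β * X₂)
    lhs = trans (∷-∷ a (w ∷ʳ α) β [] _ _ g)
      (cong₂ _+_
        (trans (lastRecursion-[]ʳ w α β ([ a ] ⊳ g))
               (recursion-cong (c α β) (refl {x = M}) ([]-right (w ∷ʳ α) _ ([ a ] ⊳ g ⊲ [ β ]))
                                                      ([]-right w _ ([ a ] ⊳ g ⊲ d α β))))
        (cong₂ (λ s t → s + c a β * t) ([]-right (a ∷ w ∷ʳ α) _ _) ([]-right (w ∷ʳ α) _ _)))
    rhs : lastExpansion (a ∷ w) [] α β g ≡ (M + (G₂ + c a β * X₂)) + (G₁ + c α β * X₁)
    rhs = cong₂ _+_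
      (trans (∷-∷-⊲ a w β [] [ α ] g)
             (recursion-cong (c a β) (refl {x = M}) ([]-right (a ∷ w) _ ([ β ] ⊳ g ⊲ [ α ]))
                                                    ([]-right w _ ((d a β ⊳ g) ⊲ [ α ]))))
      (cong₂ (λ s t → s + c α β * t) ([]-right (a ∷ w ∷ʳ α) _ _) ([]-right (a ∷ w) _ _))

  lastRecursion : ∀ w v α β g → LastRecursion w v α β g
  lastRecursion [] v α β g = lastRecursion-[]ˡ v α β g
  lastRecursion (a ∷ w) [] α β g = lastRecursion-[]ʳ (a ∷ w) α β g
  lastRecursion (a ∷ w) (b ∷ v) α β g = begin
    ⟪ P (a ∷ w ∷ʳ α) (b ∷ v ∷ʳ β) , g ⟫
      ≡⟨ ∷-∷ a (w ∷ʳ α) b (v ∷ʳ β) _ _ g ⟩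
    ⟪ P (w ∷ʳ α) (b ∷ v ∷ʳ β) , [ a ] ⊳ g ⟫
      + (⟪ P (a ∷ w ∷ʳ α) (v ∷ʳ β) , [ b ] ⊳ g ⟫ + l * ⟪ P (w ∷ʳ α) (v ∷ʳ β) , d a b ⊳ g ⟫)
      ≡⟨ recursion-cong l (lastRecursion w (b ∷ v) α β _) (lastRecursion (a ∷ w) v α β _)
                          (lastRecursion w v α β _) ⟩
    (C₁ + (C₂ + k * C₃)) + ((C₄ + (C₅ + k * C₆)) + l * (C₇ + (C₈ + k * C₉)))
      ≡⟨ regroup C₁ C₂ C₃ C₄ C₅ C₆ C₇ C₈ C₉ k l ⟩
    (C₁ + (C₄ + l * C₇)) + ((C₂ + (C₅ + l * C₈)) + k * (C₃ + (C₆ + l * C₉)))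
      ≡⟨ recursion-cong k (∷-∷-⊲ a w b (v ∷ʳ β) [ α ] g) (∷-∷-⊲ a (w ∷ʳ α) b v [ β ] g)
                          (∷-∷-⊲ a w b v (d α β) g) ⟨
    lastExpansion (a ∷ w) (b ∷ v) α β g
      ∎
    where
    k l : ℚ
    k = c α β
    l = c a b
    C₁ C₂ C₃ C₄ C₅ C₆ C₇ C₈ C₉ : ℚ
    C₁ = ⟪ P w (b ∷ v ∷ʳ β) , [ a ] ⊳ g ⊲ [ α ] ⟫
    C₂ = ⟪ P (w ∷ʳ α) (b ∷ v) , [ a ] ⊳ g ⊲ [ β ] ⟫
    C₃ = ⟪ P w (b ∷ v) , [ a ] ⊳ g ⊲ d α β ⟫
    C₄ = ⟪ P (a ∷ w) (v ∷ʳ β) , [ b ] ⊳ g ⊲ [ α ] ⟫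
    C₅ = ⟪ P (a ∷ w ∷ʳ α) v , [ b ] ⊳ g ⊲ [ β ] ⟫
    C₆ = ⟪ P (a ∷ w) v , [ b ] ⊳ g ⊲ d α β ⟫
    C₇ = ⟪ P w (v ∷ʳ β) , (d a b ⊳ g) ⊲ [ α ] ⟫
    C₈ = ⟪ P (w ∷ʳ α) v , (d a b ⊳ g) ⊲ [ β ] ⟫
    C₉ = ⟪ P w v , (d a b ⊳ g) ⊲ d α β ⟫
    regroup : ∀ C₁ C₂ C₃ C₄ C₅ C₆ C₇ C₈ C₉ k l →
      (C₁ + (C₂ + k * C₃)) + ((C₄ + (C₅ + k * C₆)) + l * (C₇ + (C₈ + k * C₉))) ≡
      (C₁ + (C₄ + l * C₇)) + ((C₂ + (C₅ + l * C₈)) + k * (C₃ + (C₆ + l * C₉)))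
    regroup = solve 11 (λ C₁ C₂ C₃ C₄ C₅ C₆ C₇ C₈ C₉ k l →
      (C₁ :+ (C₂ :+ k :* C₃)) :+ ((C₄ :+ (C₅ :+ k :* C₆)) :+ l :* (C₇ :+ (C₈ :+ k :* C₉))) :=
      (C₁ :+ (C₄ :+ l :* C₇)) :+ ((C₂ :+ (C₅ :+ l :* C₈)) :+ k :* (C₃ :+ (C₆ :+ l :* C₉)))) refl

τ-conjugate : (Word → Word → Poly) → Word → Word → Poly
τ-conjugate P w v = τ (P (τW w) (τW v))

τ-coeff : (Letter → Letter → ℚ) → Letter → Letter → ℚ
τ-coeff c a b = c (swapL a) (swapL b)

τ-word : (Letter → Letter → Word) → Letter → Letter → Word
τ-word d a b = τW (d (swapL a) (swapL b))

⟪⟫-τ-⊲ : ∀ p z g → ⟪ p , (g ∘ τW) ⊲ z ⟫ ≡ ⟪ τ p , τW z ⊳ g ⟫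
⟪⟫-τ-⊲ p z g = trans (⟪⟫-cong p (λ u → cong g (τW-++ u z))) (sym (⟪⟫-τ p (τW z ⊳ g)))

⟪⟫-τ-⊲-swapL : ∀ p a g → ⟪ p , (g ∘ τW) ⊲ [ swapL a ] ⟫ ≡ ⟪ τ p , [ a ] ⊳ g ⟫
⟪⟫-τ-⊲-swapL p a g =
  trans (⟪⟫-τ-⊲ p [ swapL a ] g) (cong (λ u → ⟪ τ p , [ u ] ⊳ g ⟫) (swapL-involutive a))

τ-conjugate-isQuasiShuffle : ∀ {Dom c d P} → IsQuasiShuffleOn U c d P →
  IsQuasiShuffleOn Dom (τ-coeff c) (τ-word d) (τ-conjugate P)
τ-conjugate-isQuasiShuffle {Dom} {c} {d} {P} qs = record
  { []-left  = λ v _ g →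
      trans (⟪⟫-τ (P [] (τW v)) g) (trans ([]-left (τW v) _ (g ∘ τW)) (cong g (τW-involutive v)))
  ; []-right = λ w _ g →
      trans (⟪⟫-τ (P (τW w) []) g) (trans ([]-right (τW w) _ (g ∘ τW)) (cong g (τW-involutive w)))
  ; ∷-∷      = headRecursion
  }
  where
  open IsQuasiShuffleOn qs
  open LastLetterRecursion qs using (lastRecursion)
  headRecursion : ∀ a w b v → Dom (a ∷ w) → Dom (b ∷ v) → ∀ g →
    HeadRecursion (τ-coeff c) (τ-word d) (τ-conjugate P) a w b v g
  headRecursion a w b v _ _ g = begin
    ⟪ τ (P (τW (a ∷ w)) (τW (b ∷ v))) , g ⟫
      ≡⟨ ⟪⟫-τ (P (τW (a ∷ w)) (τW (b ∷ v))) g ⟩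
    ⟪ P (τW (a ∷ w)) (τW (b ∷ v)) , g ∘ τW ⟫
      ≡⟨ cong₂ (λ w′ v′ → ⟪ P w′ v′ , g ∘ τW ⟫) (τW-∷ a w) (τW-∷ b v) ⟩
    ⟪ P (τW w ∷ʳ swapL a) (τW v ∷ʳ swapL b) , g ∘ τW ⟫
      ≡⟨ lastRecursion (τW w) (τW v) (swapL a) (swapL b) (g ∘ τW) ⟩
    ⟪ P (τW w) (τW v ∷ʳ swapL b) , (g ∘ τW) ⊲ [ swapL a ] ⟫
      + (⟪ P (τW w ∷ʳ swapL a) (τW v) , (g ∘ τW) ⊲ [ swapL b ] ⟫
         + τ-coeff c a b * ⟪ P (τW w) (τW v) , (g ∘ τW) ⊲ d (swapL a) (swapL b) ⟫)
      ≡⟨ recursion-cong (τ-coeff c a b)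
           (trans (cong (λ v′ → ⟪ P (τW w) v′ , (g ∘ τW) ⊲ [ swapL a ] ⟫) (sym (τW-∷ b v)))
                  (⟪⟫-τ-⊲-swapL (P (τW w) (τW (b ∷ v))) a g))
           (trans (cong (λ w′ → ⟪ P w′ (τW v) , (g ∘ τW) ⊲ [ swapL b ] ⟫) (sym (τW-∷ a w)))
                  (⟪⟫-τ-⊲-swapL (P (τW (a ∷ w)) (τW v)) b g))
           (⟪⟫-τ-⊲ (P (τW w) (τW v)) (d (swapL a) (swapL b)) g) ⟩
    ⟪ τ-conjugate P w (b ∷ v) , [ a ] ⊳ g ⟫
      + (⟪ τ-conjugate P (a ∷ w) v , [ b ] ⊳ g ⟫ + τ-coeff c a b * ⟪ τ-conjugate P w v , τ-word d a b ⊳ g ⟫)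
      ∎

shuffle-isQuasiShuffle : ∀ {Dom} → IsQuasiShuffleOn Dom (λ _ _ → 0ℚ) (λ _ _ → []) shW
shuffle-isQuasiShuffle = record
  { []-left  = λ v _ g → ⟪⟫-wd v g
  ; []-right = λ { [] _ g → ⟪⟫-wd [] g ; (a ∷ w) _ g → ⟪⟫-wd (a ∷ w) g }
  ; ∷-∷      = λ a w b v _ _ g → begin
      ⟪ lmul [ a ] (shW w (b ∷ v)) ++ lmul [ b ] (shW (a ∷ w) v) , g ⟫
        ≡⟨ ⟪⟫-++ (lmul [ a ] (shW w (b ∷ v))) _ g ⟩
      ⟪ lmul [ a ] (shW w (b ∷ v)) , g ⟫ + ⟪ lmul [ b ] (shW (a ∷ w) v) , g ⟫
        ≡⟨ cong₂ _+_ (⟪⟫-lmul [ a ] (shW w (b ∷ v)) g) (⟪⟫-lmul [ b ] (shW (a ∷ w) v) g) ⟩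
      ⟪ shW w (b ∷ v) , [ a ] ⊳ g ⟫ + ⟪ shW (a ∷ w) v , [ b ] ⊳ g ⟫
        ≡⟨ cong (⟪ shW w (b ∷ v) , [ a ] ⊳ g ⟫ +_)
                (trans (sym (+-identityʳ _))
                       (cong (⟪ shW (a ∷ w) v , [ b ] ⊳ g ⟫ +_) (sym (*-zeroˡ ⟪ shW w v , [] ⊳ g ⟫)))) ⟩
      ⟪ shW w (b ∷ v) , [ a ] ⊳ g ⟫ + (⟪ shW (a ∷ w) v , [ b ] ⊳ g ⟫ + 0ℚ * ⟪ shW w v , [] ⊳ g ⟫)
        ∎
  }

⋄Sh-coeff : Letter → Letter → ℚ
⋄Sh-coeff x x = 1ℚ
⋄Sh-coeff _ _ = - 1ℚ

⋄Sh-word : Letter → Letter → Word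
⋄Sh-word y y = y ∷ y ∷ []
⋄Sh-word _ _ = x ∷ y ∷ []

⋄Sh-monomial : ∀ a b → ⋄Sh a b ≡ (⋄Sh-coeff a b , ⋄Sh-word a b) ∷ []
⋄Sh-monomial x x = refl
⋄Sh-monomial x y = refl
⋄Sh-monomial y x = refl
⋄Sh-monomial y y = refl

⟪⟫-pmul-monomial : ∀ c u p g → ⟪ pmul ((c , u) ∷ []) p , g ⟫ ≡ c * ⟪ p , u ⊳ g ⟫
⟪⟫-pmul-monomial c u p g =
  trans (⟪⟫-bilin (λ u v → wd (u ++ v)) ((c , u) ∷ []) p g)
        (trans (+-identityʳ _) (cong (c *_) (⟪⟫-cong p (λ z → ⟪⟫-wd (u ++ z) g))))

shuffleSh-isQuasiShuffle : ∀ {Dom} → IsQuasiShuffleOn Dom ⋄Sh-coeff ⋄Sh-word shShW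
shuffleSh-isQuasiShuffle = record
  { []-left  = λ v _ g → ⟪⟫-wd v g
  ; []-right = λ { [] _ g → ⟪⟫-wd [] g ; (a ∷ w) _ g → ⟪⟫-wd (a ∷ w) g }
  ; ∷-∷      = λ a w b v _ _ g →
      trans (⟪⟫-++ (lmul [ a ] (shShW w (b ∷ v))) _ g)
        (cong₂ _+_ (⟪⟫-lmul [ a ] (shShW w (b ∷ v)) g)
          (trans (⟪⟫-++ (lmul [ b ] (shShW (a ∷ w) v)) _ g)
            (cong₂ _+_ (⟪⟫-lmul [ b ] (shShW (a ∷ w) v) g)
              (trans (cong (λ m → ⟪ pmul m (shShW w v) , g ⟫) (⋄Sh-monomial a b))
                     (⟪⟫-pmul-monomial (⋄Sh-coeff a b) (⋄Sh-word a b) (shShW w v) g)))))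
  }

data H¹ : Word → Set where
  []  : H¹ []
  y∷_ : ∀ {w} → H¹ w → H¹ (y ∷ w)
  x∷_ : ∀ {a w} → H¹ (a ∷ w) → H¹ (x ∷ a ∷ w)

H¹-tail : TailClosed H¹
H¹-tail (y∷ h) = h
H¹-tail (x∷ h) = h

H¹-∷ʳ-y : ∀ u → H¹ (u ∷ʳ y)
H¹-∷ʳ-y [] = y∷ []
H¹-∷ʳ-y (y ∷ u) = y∷ H¹-∷ʳ-y u
H¹-∷ʳ-y (x ∷ []) = x∷ y∷ []
H¹-∷ʳ-y (x ∷ a ∷ u) = x∷ H¹-∷ʳ-y (a ∷ u)

H⁰⇒H¹ : ∀ {u} → InH0W u → H¹ u
H⁰⇒H¹ (inj₁ refl) = []
H⁰⇒H¹ (inj₂ (m , refl)) = H¹-∷ʳ-y (x ∷ m)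

incrHead : List ℕ → List ℕ
incrHead [] = []
incrHead (k ∷ ks) = suc k ∷ ks

indices : ∀ {w} → H¹ w → List ℕ
indices [] = []
indices (y∷ h) = 1 ∷ indices h
indices (x∷ h) = incrHead (indices h)

indices-∷ : ∀ {a w} (h : H¹ (a ∷ w)) → Σ[ j ∈ ℕ ] Σ[ L ∈ List ℕ ] indices h ≡ suc j ∷ L
indices-∷ (y∷ h) = 0 , indices h , refl
indices-∷ (x∷ h) with indices-∷ h
... | j , L , e = suc j , L , cong incrHead e

parseZ-suc : ∀ n a w → parseZ (suc n) (a ∷ w) ≡ mapMaybe incrHead (parseZ n (a ∷ w))
parseZ-suc zero y w with parseZ zero w
... | just _  = refl
... | nothing = refl
parseZ-suc (suc n) y w with parseZ zero w
... | just _  = refl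
... | nothing = refl
parseZ-suc zero x [] = refl
parseZ-suc (suc n) x [] = refl
parseZ-suc zero x (b ∷ w) = parseZ-suc 1 b w
parseZ-suc (suc n) x (b ∷ w) = parseZ-suc (suc (suc n)) b w

parseZ-indices : ∀ {w} (h : H¹ w) → parseZ zero w ≡ just (indices h)
parseZ-indices [] = refl
parseZ-indices (y∷ h) = cong (mapMaybe (1 ∷_)) (parseZ-indices h)
parseZ-indices (x∷_ {a} {w} h) = trans (parseZ-suc 0 a w) (cong (mapMaybe incrHead) (parseZ-indices h))

zsW-indices : ∀ {w} (h : H¹ w) → zsW (indices h) ≡ w
zsW-indices [] = refl
zsW-indices (y∷ h) = cong (y ∷_) (zsW-indices h)
zsW-indices (x∷ h) with indices h | zsW-indices h | indices-∷ h
... | _ | e | j , L , refl = cong (x ∷_) e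

⟪⟫-stW : ∀ {w v K L} (hw : H¹ w) (hv : H¹ v) → indices hw ≡ K → indices hv ≡ L → ∀ g →
  ⟪ stW w v , g ⟫ ≡ ⟪ stZ K L , g ⟫
⟪⟫-stW {w} {v} hw hv refl refl g rewrite parseZ-indices hw | parseZ-indices hv = refl

⟪⟫-stZ-∷-∷ : ∀ i K j L g → ⟪ stZ (i ∷ K) (j ∷ L) , g ⟫ ≡
  ⟪ stZ K (j ∷ L) , zW i ⊳ g ⟫ + (⟪ stZ (i ∷ K) L , zW j ⊳ g ⟫ + ⟪ stZ K L , zW (i +ℕ j) ⊳ g ⟫)
⟪⟫-stZ-∷-∷ i K j L g =
  trans (⟪⟫-++ (lmul (zW i) (stZ K (j ∷ L))) _ g)
    (cong₂ _+_ (⟪⟫-lmul (zW i) (stZ K (j ∷ L)) g)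
      (trans (⟪⟫-++ (lmul (zW j) (stZ (i ∷ K) L)) _ g)
        (cong₂ _+_ (⟪⟫-lmul (zW j) (stZ (i ∷ K) L) g) (⟪⟫-lmul (zW (i +ℕ j)) (stZ K L) g))))

⟪⟫-stZ-[] : ∀ K g → ⟪ stZ K [] , g ⟫ ≡ g (zsW K)
⟪⟫-stZ-[] [] g = ⟪⟫-wd [] g
⟪⟫-stZ-[] (k ∷ K) g = ⟪⟫-wd (zsW (k ∷ K)) g

-- Letter by letter the stuffle diamond is y ⋄ y = xy, x ⋄ y = y ⋄ x = −xy, x ⋄ x = −xx, the
-- τ-conjugate of ⋄Sh: the negative diamonds cancel the cross terms created when a leading x is
-- split off z_{k+1} = x z_k.
StuffleHeadRecursion : Letter → Word → Letter → Word → Set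
StuffleHeadRecursion a w b v = ∀ g → HeadRecursion (τ-coeff ⋄Sh-coeff) (τ-word ⋄Sh-word) stW a w b v g

stuffle-yy : ∀ {w v} → H¹ w → H¹ v → StuffleHeadRecursion y w y v
stuffle-yy {w} {v} h h′ g = begin
  ⟪ stW (y ∷ w) (y ∷ v) , g ⟫      ≡⟨ ⟪⟫-stW (y∷ h) (y∷ h′) refl refl g ⟩
  ⟪ stZ (1 ∷ K) (1 ∷ L) , g ⟫      ≡⟨ ⟪⟫-stZ-∷-∷ 1 K 1 L g ⟩
  A + (B + C)                      ≡⟨ cong (λ t → A + (B + t)) (*-identityˡ C) ⟨
  A + (B + 1ℚ * C)                 ≡⟨ recursion-cong 1ℚ (⟪⟫-stW h (y∷ h′) refl refl _) (⟪⟫-stW (y∷ h) h′ refl refl _)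
                                                        (⟪⟫-stW h h′ refl refl _) ⟨
  ⟪ stW w (y ∷ v) , [ y ] ⊳ g ⟫ + (⟪ stW (y ∷ w) v , [ y ] ⊳ g ⟫ + 1ℚ * ⟪ stW w v , x ∷ y ∷ [] ⊳ g ⟫) ∎
  where
  K L : List ℕ
  K = indices h
  L = indices h′
  A B C : ℚ
  A = ⟪ stZ K (1 ∷ L) , [ y ] ⊳ g ⟫
  B = ⟪ stZ (1 ∷ K) L , [ y ] ⊳ g ⟫
  C = ⟪ stZ K L , x ∷ y ∷ [] ⊳ g ⟫

stuffle-yx : ∀ {w a v} → H¹ w → H¹ (a ∷ v) → StuffleHeadRecursion y w x (a ∷ v)
stuffle-yx {w} {a} {v} h h′ g with indices-∷ h′
... | j , L , e = begin
  ⟪ stW (y ∷ w) (x ∷ a ∷ v) , g ⟫          ≡⟨ ⟪⟫-stW (y∷ h) (x∷ h′) refl (cong incrHead e) g ⟩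
  ⟪ stZ (1 ∷ K) (suc (suc j) ∷ L) , g ⟫    ≡⟨ ⟪⟫-stZ-∷-∷ 1 K (suc (suc j)) L g ⟩
  A + (B + C)                              ≡⟨ cancel A B C E ⟩
  A + ((E + (B + C)) + - 1ℚ * E)
    ≡⟨ recursion-cong (- 1ℚ) (⟪⟫-stW h (x∷ h′) refl (cong incrHead e) _)
                             (trans (⟪⟫-stW (y∷ h) h′ refl e _) (⟪⟫-stZ-∷-∷ 1 K (suc j) L _))
                             (⟪⟫-stW h h′ refl e _) ⟨
  ⟪ stW w (x ∷ a ∷ v) , [ y ] ⊳ g ⟫
    + (⟪ stW (y ∷ w) (a ∷ v) , [ x ] ⊳ g ⟫ + - 1ℚ * ⟪ stW w (a ∷ v) , x ∷ y ∷ [] ⊳ g ⟫) ∎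
  where
  K : List ℕ
  K = indices h
  A B C E : ℚ
  A = ⟪ stZ K (suc (suc j) ∷ L) , [ y ] ⊳ g ⟫
  B = ⟪ stZ (1 ∷ K) L , zW (suc (suc j)) ⊳ g ⟫
  C = ⟪ stZ K L , zW (suc (suc (suc j))) ⊳ g ⟫
  E = ⟪ stZ K (suc j ∷ L) , x ∷ y ∷ [] ⊳ g ⟫
  cancel : ∀ A B C E → A + (B + C) ≡ A + ((E + (B + C)) + - 1ℚ * E)
  cancel = solve 4 (λ A B C E → A :+ (B :+ C) := A :+ ((E :+ (B :+ C)) :+ con (- 1ℚ) :* E)) refl

stuffle-xy : ∀ {a w v} → H¹ (a ∷ w) → H¹ v → StuffleHeadRecursion x (a ∷ w) y v
stuffle-xy {a} {w} {v} h h′ g with indices-∷ h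
... | i , K , e = begin
  ⟪ stW (x ∷ a ∷ w) (y ∷ v) , g ⟫          ≡⟨ ⟪⟫-stW (x∷ h) (y∷ h′) (cong incrHead e) refl g ⟩
  ⟪ stZ (suc (suc i) ∷ K) (1 ∷ L) , g ⟫    ≡⟨ ⟪⟫-stZ-∷-∷ (suc (suc i)) K 1 L g ⟩
  A + (B + C)                              ≡⟨ cancel A B C E ⟩
  (A + (E + C)) + (B + - 1ℚ * E)
    ≡⟨ recursion-cong (- 1ℚ) (trans (⟪⟫-stW h (y∷ h′) e refl _) (⟪⟫-stZ-∷-∷ (suc i) K 1 L _))
                             (⟪⟫-stW (x∷ h) h′ (cong incrHead e) refl _)
                             (⟪⟫-stW h h′ e refl _) ⟨
  ⟪ stW (a ∷ w) (y ∷ v) , [ x ] ⊳ g ⟫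
    + (⟪ stW (x ∷ a ∷ w) v , [ y ] ⊳ g ⟫ + - 1ℚ * ⟪ stW (a ∷ w) v , x ∷ y ∷ [] ⊳ g ⟫) ∎
  where
  L : List ℕ
  L = indices h′
  A B C E : ℚ
  A = ⟪ stZ K (1 ∷ L) , zW (suc (suc i)) ⊳ g ⟫
  B = ⟪ stZ (suc (suc i) ∷ K) L , [ y ] ⊳ g ⟫
  C = ⟪ stZ K L , zW (suc (suc i) +ℕ 1) ⊳ g ⟫
  E = ⟪ stZ (suc i ∷ K) L , x ∷ y ∷ [] ⊳ g ⟫
  cancel : ∀ A B C E → A + (B + C) ≡ (A + (E + C)) + (B + - 1ℚ * E)
  cancel = solve 4 (λ A B C E → A :+ (B :+ C) := (A :+ (E :+ C)) :+ (B :+ con (- 1ℚ) :* E)) refl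

stuffle-xx : ∀ {a w b v} → H¹ (a ∷ w) → H¹ (b ∷ v) → StuffleHeadRecursion x (a ∷ w) x (b ∷ v)
stuffle-xx {a} {w} {b} {v} h h′ g with indices-∷ h | indices-∷ h′
... | i , K , e | j , L , e′ = begin
  ⟪ stW (x ∷ a ∷ w) (x ∷ b ∷ v) , g ⟫
    ≡⟨ ⟪⟫-stW (x∷ h) (x∷ h′) (cong incrHead e) (cong incrHead e′) g ⟩
  ⟪ stZ (suc (suc i) ∷ K) (suc (suc j) ∷ L) , g ⟫
    ≡⟨ ⟪⟫-stZ-∷-∷ (suc (suc i)) K (suc (suc j)) L g ⟩
  C₁ + (C₂ + C₃)
    ≡⟨ cancel C₁ C₂ C₃ C₄ C₅ C₆ ⟩
  (C₁ + (C₄ + C₃)) + ((C₅ + (C₂ + C₆)) + - 1ℚ * (C₅ + (C₄ + C₆)))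
    ≡⟨ recursion-cong (- 1ℚ)
         (trans (⟪⟫-stW h (x∷ h′) e (cong incrHead e′) _) (⟪⟫-stZ-∷-∷ (suc i) K (suc (suc j)) L _))
         (trans (⟪⟫-stW (x∷ h) h′ (cong incrHead e) e′ _) (⟪⟫-stZ-∷-∷ (suc (suc i)) K (suc j) L _))
         (trans (⟪⟫-stW h h′ e e′ _) (⟪⟫-stZ-∷-∷ (suc i) K (suc j) L _)) ⟨
  ⟪ stW (a ∷ w) (x ∷ b ∷ v) , [ x ] ⊳ g ⟫
    + (⟪ stW (x ∷ a ∷ w) (b ∷ v) , [ x ] ⊳ g ⟫ + - 1ℚ * ⟪ stW (a ∷ w) (b ∷ v) , x ∷ x ∷ [] ⊳ g ⟫) ∎
  where
  C₁ C₂ C₃ C₄ C₅ C₆ : ℚ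
  C₁ = ⟪ stZ K (suc (suc j) ∷ L) , zW (suc (suc i)) ⊳ g ⟫
  C₂ = ⟪ stZ (suc (suc i) ∷ K) L , zW (suc (suc j)) ⊳ g ⟫
  C₃ = ⟪ stZ K L , zW (suc (suc i) +ℕ suc (suc j)) ⊳ g ⟫
  C₄ = ⟪ stZ (suc i ∷ K) L , x ∷ x ∷ zW (suc j) ⊳ g ⟫
  C₅ = ⟪ stZ K (suc j ∷ L) , x ∷ x ∷ zW (suc i) ⊳ g ⟫
  C₆ = ⟪ stZ K L , x ∷ x ∷ zW (suc i +ℕ suc j) ⊳ g ⟫
  cancel : ∀ C₁ C₂ C₃ C₄ C₅ C₆ →
    C₁ + (C₂ + C₃) ≡ (C₁ + (C₄ + C₃)) + ((C₅ + (C₂ + C₆)) + - 1ℚ * (C₅ + (C₄ + C₆)))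
  cancel = solve 6 (λ C₁ C₂ C₃ C₄ C₅ C₆ →
    C₁ :+ (C₂ :+ C₃) := (C₁ :+ (C₄ :+ C₃)) :+ ((C₅ :+ (C₂ :+ C₆)) :+ con (- 1ℚ) :* (C₅ :+ (C₄ :+ C₆)))) refl

stuffle-isQuasiShuffle : IsQuasiShuffleOn H¹ (τ-coeff ⋄Sh-coeff) (τ-word ⋄Sh-word) stW
stuffle-isQuasiShuffle = record
  { []-left  = λ v hv g → trans (⟪⟫-stW [] hv refl refl g) (trans (⟪⟫-wd _ g) (cong g (zsW-indices hv)))
  ; []-right = λ w hw g →
      trans (⟪⟫-stW hw [] refl refl g) (trans (⟪⟫-stZ-[] (indices hw) g) (cong g (zsW-indices hw)))
  ; ∷-∷      = headRecursion
  }
  where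
  headRecursion : ∀ a w b v → H¹ (a ∷ w) → H¹ (b ∷ v) → StuffleHeadRecursion a w b v
  headRecursion y w y v (y∷ h) (y∷ h′) = stuffle-yy h h′
  headRecursion y w x (b ∷ v) (y∷ h) (x∷ h′) = stuffle-yx h h′
  headRecursion x (a ∷ w) y v (x∷ h) (y∷ h′) = stuffle-xy h h′
  headRecursion x (a ∷ w) x (b ∷ v) (x∷ h) (x∷ h′) = stuffle-xx h h′

⟪⟫-bilin-τ : ∀ {Dom : Pred Word 0ℓ} F G p q g → All (Dom ∘ proj₂) p → All (Dom ∘ proj₂) q →
  (∀ {a b} → Dom a → Dom b → ⟪ F a b , g ⟫ ≡ ⟪ τ-conjugate G a b , g ⟫) →
  ⟪ bilin F p q , g ⟫ ≡ ⟪ bilin G (τ p) (τ q) , g ∘ τW ⟫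
⟪⟫-bilin-τ F G p q g hp hq e = begin
  ⟪ bilin F p q , g ⟫
    ≡⟨ ⟪⟫-bilin F p q g ⟩
  ⟪ p , (λ a → ⟪ q , (λ b → ⟪ F a b , g ⟫) ⟫) ⟫
    ≡⟨ ⟪⟫-cong-local p (All.map (λ {s} hs → ⟪⟫-cong-local q (All.map (λ {t} ht →
         trans (e hs ht) (⟪⟫-τ (G (τW (proj₂ s)) (τW (proj₂ t))) g)) hq)) hp) ⟩
  ⟪ p , (λ a → ⟪ q , (λ b → ⟪ G (τW a) (τW b) , g ∘ τW ⟫) ⟫) ⟫
    ≡⟨ ⟪⟫-cong p (λ a → ⟪⟫-τ q _) ⟨
  ⟪ p , (λ a → ⟪ τ q , (λ b → ⟪ G (τW a) b , g ∘ τW ⟫) ⟫) ⟫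
    ≡⟨ ⟪⟫-τ p _ ⟨
  ⟪ τ p , (λ a → ⟪ τ q , (λ b → ⟪ G a b , g ∘ τW ⟫) ⟫) ⟫
    ≡⟨ ⟪⟫-bilin G (τ p) (τ q) (g ∘ τW) ⟨
  ⟪ bilin G (τ p) (τ q) , g ∘ τW ⟫
    ∎

shuffle-τ : ∀ p q g → ⟪ p ⧢ q , g ⟫ ≡ ⟪ τ p ⧢ τ q , g ∘ τW ⟫
shuffle-τ p q g = ⟪⟫-bilin-τ shW shW p q g (All.universal-U p) (All.universal-U q)
  (λ {a} {b} _ _ → quasiShuffle-unique {Dom = U} (λ _ → tt) shuffle-isQuasiShuffle
                     (τ-conjugate-isQuasiShuffle shuffle-isQuasiShuffle) a b tt tt g)

stuffle-τ : ∀ p q g → All (H¹ ∘ proj₂) p → All (H¹ ∘ proj₂) q →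
  ⟪ p ✱ q , g ⟫ ≡ ⟪ τ p ⧢Sh τ q , g ∘ τW ⟫
stuffle-τ p q g hp hq = ⟪⟫-bilin-τ stW shShW p q g hp hq
  (λ {a} {b} ha hb → quasiShuffle-unique H¹-tail stuffle-isQuasiShuffle
                       (τ-conjugate-isQuasiShuffle shuffleSh-isQuasiShuffle) a b ha hb g)

proposition3p25 : (w v : Poly) → InH0 w → InH0 v →
    ds w v ≈ neg (τ (D (τ w) (τ v)))
proposition3p25 w v hw hv = ≈-by-⟪⟫ {ds w v} {neg (τ (D (τ w) (τ v)))} λ g → begin
  ⟪ ds w v , g ⟫
    ≡⟨ ⟪⟫-⊖ (w ⧢ v) (w ✱ v) g ⟩
  ⟪ w ⧢ v , g ⟫ + - 1ℚ * ⟪ w ✱ v , g ⟫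
    ≡⟨ cong₂ (λ s t → s + - 1ℚ * t) (shuffle-τ w v g)
             (stuffle-τ w v g (All.map H⁰⇒H¹ hw) (All.map H⁰⇒H¹ hv)) ⟩
  ⟪ τ w ⧢ τ v , g ∘ τW ⟫ + - 1ℚ * ⟪ τ w ⧢Sh τ v , g ∘ τW ⟫
    ≡⟨ negate-difference ⟪ τ w ⧢ τ v , g ∘ τW ⟫ ⟪ τ w ⧢Sh τ v , g ∘ τW ⟫ ⟩
  - 1ℚ * (⟪ τ w ⧢Sh τ v , g ∘ τW ⟫ + - 1ℚ * ⟪ τ w ⧢ τ v , g ∘ τW ⟫)
    ≡⟨ cong (- 1ℚ *_) (trans (⟪⟫-τ (D (τ w) (τ v)) g) (⟪⟫-⊖ (τ w ⧢Sh τ v) (τ w ⧢ τ v) (g ∘ τW))) ⟨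
  - 1ℚ * ⟪ τ (D (τ w) (τ v)) , g ⟫
    ≡⟨ ⟪⟫-scale (- 1ℚ) (τ (D (τ w) (τ v))) g ⟨
  ⟪ neg (τ (D (τ w) (τ v))) , g ⟫
    ∎
  where
  negate-difference : ∀ A B → A + - 1ℚ * B ≡ - 1ℚ * (B + - 1ℚ * A)
  negate-difference = solve 2 (λ A B → A :+ con (- 1ℚ) :* B := con (- 1ℚ) :* (B :+ con (- 1ℚ) :* A)) refl
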